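{- Let $(G,<)$ be a partially ordered abelian group, $0<u\in G$, $C=G/\mathbb{Z}u$ and $\rho:G\to C$ the canonical map. (1) For every $x,y\in G$ there exists at most one $n\in\mathbb{Z}$ such that $x<y+nu<x+u$. (2) For $x_1,x_2,x_3\in G$ set $R(\rho(x_1),\rho(x_2),\rho(x_3))$ if, and only if, there exist $n_2,n_3\in\mathbb{Z}$ with $x_1<x_2+n_2u<x_3+n_3u<x_1+u$. Then $R$ is a well-defined ternary relation on $C$ and $(C,R)$ is a p.c.o. group.
   Context: A partially cyclically ordered group (p.c.o. group) is an abelian group $C$ with a ternary relation $R$ such that for all $x,y,z,v\in C$: (1) $R(x,y,z)\Rightarrow x\neq y\neq z\neq x$; (2) $R(x,y,z)\Rightarrow R(y,z,x)$; (3) for every $x\in C$, the relation $y\leq_x z$ defined by "$R(x,y,z)$ or $y=z$ or $y=x$" is a partial order on $C$; (4) $R(x,y,z)\Rightarrow R(x+v,y+v,z+v)$. -}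

module Defs where

open import Level using (Level; _⊔_; suc)
open import Data.Nat using (ℕ)
import Data.Nat as ℕ
open import Data.Integer using (ℤ; +_; -[1+_])
open import Data.Product using (_×_; ∃; ∃₂)
open import Data.Sum using (_⊎_)
open import Relation.Nullary using (¬_)
open import Relation.Binary.Core using (Rel)
open import Relation.Binary.Structures using (IsPartialOrder)
open import Algebra.Bundles using (AbelianGroup)
open import Algebra.Structures using (IsAbelianGroup)
import Algebra.Definitions.RawMonoid as RawMonoidDefs

record POAbelianGroup (c ℓ₁ ℓ₂ : Level) : Set (suc (c ⊔ ℓ₁ ⊔ ℓ₂)) where
  field
    abelianGroup   : AbelianGroup c ℓ₁
  open AbelianGroup abelianGroup public
  field
    _≤_            : Rel Carrier ℓ₂
    isPartialOrder : IsPartialOrder _≈_ _≤_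
    ≤-compat       : ∀ {x y} z → x ≤ y → (x ∙ z) ≤ (y ∙ z)

  _<_ : Rel Carrier (ℓ₁ ⊔ ℓ₂)
  x < y = (x ≤ y) × ¬ (x ≈ y)

WellDefined : ∀ {a ℓ r} {A : Set a} → Rel A ℓ → (A → A → A → Set r) → Set (a ⊔ ℓ ⊔ r)
WellDefined _≈_ R = ∀ {x₁ x₂ x₃ y₁ y₂ y₃} →
  x₁ ≈ y₁ → x₂ ≈ y₂ → x₃ ≈ y₃ → R x₁ x₂ x₃ → R y₁ y₂ y₃

-- The axioms (1)-(4) of a partially cyclically ordered group, for a
-- group whose equality is _≈_ (a setoid: C is a quotient).
record IsPCOGroup {a ℓ r} {A : Set a} (_≈_ : Rel A ℓ) (_+_ : A → A → A)
                  (R : A → A → A → Set r) : Set (a ⊔ ℓ ⊔ r) where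
  field
    distinct  : ∀ {x y z} → R x y z → ¬ (x ≈ y) × ¬ (y ≈ z) × ¬ (z ≈ x)
    cyclic    : ∀ {x y z} → R x y z → R y z x
    partial   : ∀ x → IsPartialOrder _≈_ (λ y z → R x y z ⊎ (y ≈ z) ⊎ (y ≈ x))
    translate : ∀ {x y z} v → R x y z → R (x + v) (y + v) (z + v)

module Cyclic {c ℓ₁ ℓ₂} (G : POAbelianGroup c ℓ₁ ℓ₂) (u : POAbelianGroup.Carrier G) where
  open POAbelianGroup G
  open RawMonoidDefs rawMonoid using () renaming (_×_ to _×ℕ_)

  _·u : ℤ → Carrier
  (+ n) ·u    = n ×ℕ u
  -[1+ n ] ·u = (ℕ.suc n ×ℕ u) ⁻¹

  -- x ~ y  iff  x and y have the same image in C = G / ℤu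
  _~_ : Rel Carrier ℓ₁
  x ~ y = ∃ λ (n : ℤ) → x ≈ (y ∙ (n ·u))

  R : Carrier → Carrier → Carrier → Set (ℓ₁ ⊔ ℓ₂)
  R x₁ x₂ x₃ = ∃₂ λ (n₂ n₃ : ℤ) →
    (x₁ < (x₂ ∙ (n₂ ·u))) × ((x₂ ∙ (n₂ ·u)) < (x₃ ∙ (n₃ ·u))) × ((x₃ ∙ (n₃ ·u)) < (x₁ ∙ u))

module Submission where

open import Defs
open import Data.Integer using (ℤ)
open import Data.Product using (_×_)
open import Relation.Binary.PropositionalEquality using (_≡_)
open import Algebra.Structures using (IsAbelianGroup)

-- Everything rests on one fact about the window ]a, a + u[ when ε ≤ u: the
-- multiples n·u are monotone in n, so no translate a + j·u lies strictly
-- inside it (`no-multiple-in-gap`).  Hence two points of a window are never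
-- congruent mod u (`gap-incongruent`, giving distinctness), and y enters the
-- window of x through at most one multiple of u (`window-unique`: part (1),
-- and the key to the partial orders ≤ₓ).

open import Data.Integer using (+_; -[1+_])
import Data.Integer as ℤ
import Data.Integer.Properties as ℤₚ
open import Data.Integer.Tactic.RingSolver using (solve-∀)
import Data.Nat as ℕ
open import Level using (_⊔_)
import Data.Nat.Properties as ℕₚ
open import Data.Product using (_,_; proj₁; proj₂)
open import Data.Sum using (_⊎_; inj₁; inj₂)
open import Data.Empty using (⊥; ⊥-elim)
open import Function.Base using (_∘_)
open import Relation.Nullary using (¬_; yes; no)
import Relation.Binary.PropositionalEquality as ≡
open import Relation.Binary.Bundles using (Poset)
open import Relation.Binary.Structures using (IsEquivalence; IsPartialOrder)
import Relation.Binary.Properties.Poset as PosetProperties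

m+[n-m]≡n : ∀ m n → m ℤ.+ (n ℤ.- m) ≡ n
m+[n-m]≡n = solve-∀

module CyclicQuotient {c ℓ₁ ℓ₂} (G : POAbelianGroup c ℓ₁ ℓ₂) (u : POAbelianGroup.Carrier G) where
  open POAbelianGroup G
  open Cyclic G u
  open import Algebra.Properties.AbelianGroup abelianGroup
    using (⁻¹-∙-comm; ∙-cancelʳ; inverseˡ-unique; ε⁻¹≈ε)
  open import Algebra.Properties.CommutativeSemigroup commutativeSemigroup
    using (interchange; xy∙z≈xz∙y)
  open import Algebra.Properties.Monoid.Mult monoid using (×-homo-+)
  open import Relation.Binary.Reasoning.Setoid setoid
  module ≤ = IsPartialOrder isPartialOrder

  poset : Poset c ℓ₁ ℓ₂
  poset = record { isPartialOrder = isPartialOrder }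

  -- The strict order x < y = x ≤ y ∧ x ≉ y is the one derived from the poset.
  open PosetProperties poset using (<-trans; <-asym; <-respˡ-≈; <-respʳ-≈; <⇒≱)

  ≤-compatˡ : ∀ {x y} z → x ≤ y → (z ∙ x) ≤ (z ∙ y)
  ≤-compatˡ z x≤y = ≤.≤-respʳ-≈ (comm _ _) (≤.≤-respˡ-≈ (comm _ _) (≤-compat z x≤y))

  <-compat : ∀ {x y} z → x < y → (x ∙ z) < (y ∙ z)
  <-compat z (x≤y , x≉y) = ≤-compat z x≤y , x≉y ∘ ∙-cancelʳ z _ _

  ·u-1 : (+ 1) ·u ≈ u
  ·u-1 = identityʳ u

  ⊖-·u : ∀ a b → (a ℤ.⊖ b) ·u ≈ (+ a) ·u ∙ ((+ b) ·u) ⁻¹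
  ⊖-·u a ℕ.zero = begin
    (+ a) ·u           ≈⟨ identityʳ _ ⟨
    (+ a) ·u ∙ ε       ≈⟨ ∙-congˡ ε⁻¹≈ε ⟨
    (+ a) ·u ∙ ε ⁻¹    ∎
  ⊖-·u ℕ.zero (ℕ.suc b) = sym (identityˡ _)
  ⊖-·u (ℕ.suc a) (ℕ.suc b) = begin
    (ℕ.suc a ℤ.⊖ ℕ.suc b) ·u  ≡⟨ ≡.cong _·u (ℤₚ.[1+m]⊖[1+n]≡m⊖n a b) ⟩
    (a ℤ.⊖ b) ·u              ≈⟨ ⊖-·u a b ⟩
    A ∙ B ⁻¹                  ≈⟨ identityˡ _ ⟨
    ε ∙ (A ∙ B ⁻¹)            ≈⟨ ∙-congʳ (inverseʳ u) ⟨
    (u ∙ u ⁻¹) ∙ (A ∙ B ⁻¹)   ≈⟨ interchange u (u ⁻¹) A (B ⁻¹) ⟩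
    (u ∙ A) ∙ (u ⁻¹ ∙ B ⁻¹)   ≈⟨ ∙-congˡ (⁻¹-∙-comm u B) ⟩
    (u ∙ A) ∙ (u ∙ B) ⁻¹      ∎
    where
    A = (+ a) ·u
    B = (+ b) ·u

  ·u-homo : ∀ m n → (m ℤ.+ n) ·u ≈ m ·u ∙ n ·u
  ·u-homo (+ a)    (+ b)    = ×-homo-+ u a b
  ·u-homo (+ a)    -[1+ b ] = ⊖-·u a (ℕ.suc b)
  ·u-homo -[1+ a ] (+ b)    = trans (⊖-·u b (ℕ.suc a)) (comm _ _)
  ·u-homo -[1+ a ] -[1+ b ] = begin
    ((+ ℕ.suc (ℕ.suc (a ℕ.+ b))) ·u) ⁻¹      ≡⟨ ≡.cong (λ k → ((+ ℕ.suc k) ·u) ⁻¹) (ℕₚ.+-suc a b) ⟨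
    ((+ (ℕ.suc a ℕ.+ ℕ.suc b)) ·u) ⁻¹        ≈⟨ ⁻¹-cong (×-homo-+ u (ℕ.suc a) (ℕ.suc b)) ⟩
    ((+ ℕ.suc a) ·u ∙ (+ ℕ.suc b) ·u) ⁻¹     ≈⟨ ⁻¹-∙-comm _ _ ⟨
    -[1+ a ] ·u ∙ -[1+ b ] ·u                ∎

  ·u-neg : ∀ n → (n ·u) ⁻¹ ≈ (ℤ.- n) ·u
  ·u-neg n = sym (inverseˡ-unique _ _ (begin
    (ℤ.- n) ·u ∙ n ·u   ≈⟨ ·u-homo (ℤ.- n) n ⟨
    (ℤ.- n ℤ.+ n) ·u    ≡⟨ ≡.cong _·u (ℤₚ.+-inverseˡ n) ⟩
    ε                   ∎))

  ·u-shift : ∀ x m n → x ∙ m ·u ∙ n ·u ≈ x ∙ (m ℤ.+ n) ·u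
  ·u-shift x m n = trans (assoc _ _ _) (∙-congˡ (sym (·u-homo m n)))

  ·u-cancel : ∀ x n → x ∙ n ·u ∙ (ℤ.- n) ·u ≈ x
  ·u-cancel x n = begin
    x ∙ n ·u ∙ (ℤ.- n) ·u   ≈⟨ ·u-shift x n (ℤ.- n) ⟩
    x ∙ (n ℤ.- n) ·u        ≡⟨ ≡.cong (λ k → x ∙ k ·u) (ℤₚ.+-inverseʳ n) ⟩
    x ∙ ε                   ≈⟨ identityʳ x ⟩
    x                       ∎

  ·u-reindex : ∀ x k n → x ∙ n ·u ≈ x ∙ k ·u ∙ (n ℤ.- k) ·u
  ·u-reindex x k n = begin
    x ∙ n ·u                   ≡⟨ ≡.cong (λ j → x ∙ j ·u) (m+[n-m]≡n k n) ⟨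
    x ∙ (k ℤ.+ (n ℤ.- k)) ·u   ≈⟨ ·u-shift x k (n ℤ.- k) ⟨
    x ∙ k ·u ∙ (n ℤ.- k) ·u    ∎

  -- Congruence modulo u: the quotient group C = G/ℤu

  ~-refl : ∀ {x} → x ~ x
  ~-refl {x} = + 0 , sym (identityʳ x)

  ~-sym : ∀ {x y} → x ~ y → y ~ x
  ~-sym {x} {y} (n , x≈) = ℤ.- n , sym (trans (∙-congʳ x≈) (·u-cancel y n))

  ~-trans : ∀ {x y z} → x ~ y → y ~ z → x ~ z
  ~-trans {z = z} (n , x≈) (m , y≈) = m ℤ.+ n , trans x≈ (trans (∙-congʳ y≈) (·u-shift z m n))

  ~-isEquivalence : IsEquivalence _~_
  ~-isEquivalence = record { refl = ~-refl ; sym = ~-sym ; trans = ~-trans }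

  ≈⇒~ : ∀ {x y} → x ≈ y → x ~ y
  ≈⇒~ {y = y} x≈y = + 0 , trans x≈y (sym (identityʳ y))

  ·u-~ : ∀ x n → (x ∙ n ·u) ~ x
  ·u-~ x n = n , refl

  ∙u-~ : ∀ x → (x ∙ u) ~ x
  ∙u-~ x = + 1 , ∙-congˡ (sym ·u-1)

  ~-∙-cong : ∀ {x y x′ y′} → x ~ y → x′ ~ y′ → (x ∙ x′) ~ (y ∙ y′)
  ~-∙-cong {y = y} {y′ = y′} (n , x≈) (m , x′≈) = n ℤ.+ m , (begin
    _ ∙ _                     ≈⟨ ∙-cong x≈ x′≈ ⟩
    (y ∙ n ·u) ∙ (y′ ∙ m ·u)  ≈⟨ interchange y (n ·u) y′ (m ·u) ⟩
    (y ∙ y′) ∙ (n ·u ∙ m ·u)  ≈⟨ ∙-congˡ (·u-homo n m) ⟨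
    (y ∙ y′) ∙ (n ℤ.+ m) ·u   ∎)

  ~-⁻¹-cong : ∀ {x y} → x ~ y → (x ⁻¹) ~ (y ⁻¹)
  ~-⁻¹-cong {y = y} (n , x≈) = ℤ.- n , (begin
    _ ⁻¹                   ≈⟨ ⁻¹-cong x≈ ⟩
    (y ∙ n ·u) ⁻¹          ≈⟨ ⁻¹-∙-comm y (n ·u) ⟨
    y ⁻¹ ∙ (n ·u) ⁻¹       ≈⟨ ∙-congˡ (·u-neg n) ⟩
    y ⁻¹ ∙ (ℤ.- n) ·u      ∎)

  ~-isAbelianGroup : IsAbelianGroup _~_ _∙_ ε _⁻¹
  ~-isAbelianGroup = record
    { isGroup = record
      { isMonoid = record
        { isSemigroup = record
          { isMagma = record { isEquivalence = ~-isEquivalence ; ∙-cong = ~-∙-cong }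
          ; assoc   = λ x y z → ≈⇒~ (assoc x y z)
          }
        ; identity = (λ x → ≈⇒~ (identityˡ x)) , (λ x → ≈⇒~ (identityʳ x))
        }
      ; inverse = (λ x → ≈⇒~ (inverseˡ x)) , (λ x → ≈⇒~ (inverseʳ x))
      ; ⁻¹-cong = ~-⁻¹-cong
      }
    ; comm = λ x y → ≈⇒~ (comm x y)
    }

  -- R is a well-defined, translation invariant, cyclic relation on C

  R-resp-≈ : ∀ {x y z x′ y′ z′} → x ≈ x′ → y ≈ y′ → z ≈ z′ → R x y z → R x′ y′ z′
  R-resp-≈ x≈ y≈ z≈ (a , b , p , q , r) = a , b ,
    <-respˡ-≈ x≈ (<-respʳ-≈ (∙-congʳ y≈) p) ,
    <-respˡ-≈ (∙-congʳ y≈) (<-respʳ-≈ (∙-congʳ z≈) q) ,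
    <-respˡ-≈ (∙-congʳ z≈) (<-respʳ-≈ (∙-congʳ x≈) r)

  -- The second and third representatives may be moved by any multiples of u:
  -- the witnesses n₂, n₃ absorb the change.
  R-shiftʳ : ∀ {x y z} k l → R x y z → R x (y ∙ k ·u) (z ∙ l ·u)
  R-shiftʳ {y = y} {z} k l (a , b , p , q , r) = a ℤ.- k , b ℤ.- l ,
    <-respʳ-≈ (·u-reindex y k a) p ,
    <-respˡ-≈ (·u-reindex y k a) (<-respʳ-≈ (·u-reindex z l b) q) ,
    <-respˡ-≈ (·u-reindex z l b) r

  R-translate : ∀ {x y z} v → R x y z → R (x ∙ v) (y ∙ v) (z ∙ v)
  R-translate {x} {y} {z} v (a , b , p , q , r) = a , b ,
    <-respʳ-≈ (xy∙z≈xz∙y y (a ·u) v) (<-compat v p) ,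
    <-respˡ-≈ (xy∙z≈xz∙y y (a ·u) v) (<-respʳ-≈ (xy∙z≈xz∙y z (b ·u) v) (<-compat v q)) ,
    <-respˡ-≈ (xy∙z≈xz∙y z (b ·u) v) (<-respʳ-≈ (xy∙z≈xz∙y x u v) (<-compat v r))

  -- The first representative may be moved too: translate everything by k·u,
  -- then move the other two back.
  R-shiftˡ : ∀ {x y z} k → R x y z → R (x ∙ k ·u) y z
  R-shiftˡ {y = y} {z} k h =
    R-resp-≈ refl (·u-cancel y k) (·u-cancel z k)
      (R-shiftʳ (ℤ.- k) (ℤ.- k) (R-translate (k ·u) h))

  R-wellDefined : WellDefined _~_ R
  R-wellDefined x₁~y₁ x₂~y₂ x₃~y₃ h with ~-sym x₁~y₁ | ~-sym x₂~y₂ | ~-sym x₃~y₃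
  ... | k₁ , y₁≈ | k₂ , y₂≈ | k₃ , y₃≈ =
    R-resp-≈ (sym y₁≈) (sym y₂≈) (sym y₃≈) (R-shiftˡ k₁ (R-shiftʳ k₂ k₃ h))

  -- From x < y+a < z+b < x+u we get y+a < z+b < x+u < (y+a)+u.
  R-cyclic : ∀ {x y z} → R x y z → R y z x
  R-cyclic {x} {y} {z} (a , b , p , q , r) =
    R-resp-≈ (·u-cancel y a) refl refl (R-shiftˡ (ℤ.- a) R[y+a,z,x])
    where
    R[y+a,z,x] : R (y ∙ a ·u) z x
    R[y+a,z,x] = b , + 1 , q ,
      <-respʳ-≈ (∙-congˡ (sym ·u-1)) r ,
      <-respˡ-≈ (∙-congˡ (sym ·u-1)) (<-compat u p)

  -- Windows ]a, a + u[ for ε ≤ u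

  module NonNegative (0≤u : ε ≤ u) where

    ×u-nonneg : ∀ k → ε ≤ ((+ k) ·u)
    ×u-nonneg ℕ.zero    = ≤.refl
    ×u-nonneg (ℕ.suc k) =
      ≤.trans 0≤u (≤.≤-respˡ-≈ (identityʳ u) (≤-compatˡ u (×u-nonneg k)))

    ·u-mono : ∀ {m n} → m ℤ.≤ n → (m ·u) ≤ (n ·u)
    ·u-mono {m} {n} m≤n =
      ≤.≤-respʳ-≈ m+[n-m] (≤.≤-respˡ-≈ (identityʳ _) (≤-compatˡ (m ·u) gap-nonneg))
      where
      gap-nonneg : ε ≤ ((n ℤ.- m) ·u)
      gap-nonneg = ≤.≤-respʳ-≈
        (reflexive (≡.cong _·u (ℤₚ.0≤i⇒+∣i∣≡i (ℤₚ.i≤j⇒0≤j-i m≤n)))) (×u-nonneg ℤ.∣ n ℤ.- m ∣)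
      m+[n-m] : m ·u ∙ (n ℤ.- m) ·u ≈ n ·u
      m+[n-m] = trans (sym (·u-homo m (n ℤ.- m))) (reflexive (≡.cong _·u (m+[n-m]≡n m n)))

    -- The key fact: j ≤ 0 puts a + j·u below a, and j ≥ 1 puts it above a + u.
    no-multiple-in-gap : ∀ a j → a < (a ∙ j ·u) → (a ∙ j ·u) < (a ∙ u) → ⊥
    no-multiple-in-gap a j lower upper with j ℤₚ.≤? ℤ.0ℤ
    ... | yes j≤0 =
      <⇒≱ lower (≤.≤-respʳ-≈ (identityʳ a) (≤-compatˡ a (·u-mono j≤0)))
    ... | no  j≰0 =
      <⇒≱ upper (≤.≤-respˡ-≈ (∙-congˡ ·u-1)
        (≤-compatˡ a (·u-mono (ℤₚ.i<j⇒suc[i]≤j (ℤₚ.≰⇒> j≰0)))))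

    gap-incongruent : ∀ {a b} → a < b → b < (a ∙ u) → ¬ (b ~ a)
    gap-incongruent lower upper (j , b≈) =
      no-multiple-in-gap _ j (<-respʳ-≈ b≈ lower) (<-respˡ-≈ b≈ upper)

    -- If y + n·u lies above x and y + m·u below x + u, then m ≤ n:
    -- otherwise y + m·u ≥ y + n·u + u > x + u.
    window-below : ∀ {x y n m} → x < (y ∙ n ·u) → (y ∙ m ·u) < (x ∙ u) → m ℤ.≤ n
    window-below {x} {y} {n} {m} lower upper with m ℤₚ.≤? n
    ... | yes m≤n = m≤n
    ... | no  m≰n = ⊥-elim (<⇒≱ upper (≤.trans (proj₁ (<-compat u lower))
            (≤.≤-respˡ-≈ next (≤-compatˡ y (·u-mono (ℤₚ.i<j⇒suc[i]≤j (ℤₚ.≰⇒> m≰n)))))))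
      where
      next : y ∙ (ℤ.suc n) ·u ≈ y ∙ n ·u ∙ u
      next = begin
        y ∙ (ℤ.suc n) ·u       ≡⟨ ≡.cong (λ k → y ∙ k ·u) (ℤₚ.+-comm (+ 1) n) ⟩
        y ∙ (n ℤ.+ + 1) ·u     ≈⟨ ·u-shift y n (+ 1) ⟨
        y ∙ n ·u ∙ (+ 1) ·u    ≈⟨ ∙-congˡ ·u-1 ⟩
        y ∙ n ·u ∙ u           ∎

    window-unique : ∀ (x y : Carrier) (n m : ℤ) →
      x < (y ∙ n ·u) → (y ∙ n ·u) < (x ∙ u) →
      x < (y ∙ m ·u) → (y ∙ m ·u) < (x ∙ u) → n ≡ m
    window-unique x y n m lowerₙ upperₙ lowerₘ upperₘ =
      ℤₚ.≤-antisym (window-below lowerₘ upperₙ) (window-below lowerₙ upperₘ)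

    -- Axiom (1): each pair of consecutive points of x < y+a < z+b < x+u lies
    -- in one window, so the three classes are pairwise distinct.
    R-distinct : ∀ {x y z} → R x y z → ¬ (x ~ y) × ¬ (y ~ z) × ¬ (z ~ x)
    R-distinct {x} {y} {z} (a , b , p , q , r) =
      (λ x~y → gap-incongruent p (<-trans q r) (~-trans (·u-~ y a) (~-sym x~y))) ,
      (λ y~z → gap-incongruent q (<-trans r (<-compat u p))
                 (~-trans (·u-~ z b) (~-trans (~-sym y~z) (~-sym (·u-~ y a))))) ,
      (λ z~x → gap-incongruent r (<-compat u (<-trans p q))
                 (~-trans (∙u-~ x) (~-trans (~-sym z~x) (~-sym (·u-~ z b)))))

    module Based (x : Carrier) where

      _≤ₓ_ : Carrier → Carrier → Set (ℓ₁ ⊔ ℓ₂)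
      y ≤ₓ z = R x y z ⊎ (y ~ z) ⊎ (y ~ x)

      -- Within the window of x, the shift of the middle point is unique,
      -- so two R-steps from x compose, and cannot go back and forth.
      R-trans : ∀ {y z w} → R x y z → R x z w → R x y w
      R-trans (a , b , p , q , r) (c , d , p′ , q′ , r′)
        with window-unique x _ b c (<-trans p q) r p′ (<-trans q′ r′)
      ... | ≡.refl = a , d , p , <-trans q q′ , r′

      R-asym : ∀ {y z} → R x y z → R x z y → ⊥
      R-asym (a , b , p , q , r) (c , d , p′ , q′ , r′)
        with window-unique x _ a d p (<-trans q r) (<-trans p′ q′) r′
           | window-unique x _ b c (<-trans p q) r p′ (<-trans q′ r′)
      ... | ≡.refl | ≡.refl = <-asym q q′

      ≤ₓ-trans : ∀ {y z w} → y ≤ₓ z → z ≤ₓ w → y ≤ₓ w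
      ≤ₓ-trans (inj₁ xyz)       (inj₁ xzw)       = inj₁ (R-trans xyz xzw)
      ≤ₓ-trans (inj₁ xyz)       (inj₂ (inj₁ z~w)) = inj₁ (R-wellDefined ~-refl ~-refl z~w xyz)
      ≤ₓ-trans (inj₁ xyz)       (inj₂ (inj₂ z~x)) = ⊥-elim (proj₂ (proj₂ (R-distinct xyz)) z~x)
      ≤ₓ-trans (inj₂ (inj₁ y~z)) (inj₁ xzw)       = inj₁ (R-wellDefined ~-refl (~-sym y~z) ~-refl xzw)
      ≤ₓ-trans (inj₂ (inj₁ y~z)) (inj₂ (inj₁ z~w)) = inj₂ (inj₁ (~-trans y~z z~w))
      ≤ₓ-trans (inj₂ (inj₁ y~z)) (inj₂ (inj₂ z~x)) = inj₂ (inj₂ (~-trans y~z z~x))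
      ≤ₓ-trans (inj₂ (inj₂ y~x)) _                 = inj₂ (inj₂ y~x)

      ≤ₓ-antisym : ∀ {y z} → y ≤ₓ z → z ≤ₓ y → y ~ z
      ≤ₓ-antisym (inj₁ xyz)       (inj₁ xzy)       = ⊥-elim (R-asym xyz xzy)
      ≤ₓ-antisym (inj₁ xyz)       (inj₂ (inj₁ z~y)) = ⊥-elim (proj₁ (proj₂ (R-distinct xyz)) (~-sym z~y))
      ≤ₓ-antisym (inj₁ xyz)       (inj₂ (inj₂ z~x)) = ⊥-elim (proj₂ (proj₂ (R-distinct xyz)) z~x)
      ≤ₓ-antisym (inj₂ (inj₁ y~z)) _                 = y~z
      ≤ₓ-antisym (inj₂ (inj₂ y~x)) (inj₁ xzy)       = ⊥-elim (proj₂ (proj₂ (R-distinct xzy)) y~x)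
      ≤ₓ-antisym (inj₂ (inj₂ y~x)) (inj₂ (inj₁ z~y)) = ~-sym z~y
      ≤ₓ-antisym (inj₂ (inj₂ y~x)) (inj₂ (inj₂ z~x)) = ~-trans y~x (~-sym z~x)

      ≤ₓ-isPartialOrder : IsPartialOrder _~_ _≤ₓ_
      ≤ₓ-isPartialOrder = record
        { isPreorder = record
          { isEquivalence = ~-isEquivalence
          ; reflexive     = inj₂ ∘ inj₁
          ; trans         = ≤ₓ-trans
          }
        ; antisym = ≤ₓ-antisym
        }

    R-isPCOGroup : IsPCOGroup _~_ _∙_ R
    R-isPCOGroup = record
      { distinct  = R-distinct
      ; cyclic    = R-cyclic
      ; partial   = Based.≤ₓ-isPartialOrder
      ; translate = R-translate
      }

proposition3p16 : ∀ {c ℓ₁ ℓ₂} (G : POAbelianGroup c ℓ₁ ℓ₂) (u : POAbelianGroup.Carrier G) →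
    let open POAbelianGroup G
        open Cyclic G u
    in ε < u →
       (∀ (x y : Carrier) (n m : ℤ) →
          x < (y ∙ (n ·u)) → (y ∙ (n ·u)) < (x ∙ u) →
          x < (y ∙ (m ·u)) → (y ∙ (m ·u)) < (x ∙ u) → n ≡ m)
       × WellDefined _~_ R
       × IsAbelianGroup _~_ _∙_ ε _⁻¹
       × IsPCOGroup _~_ _∙_ R
proposition3p16 G u (0≤u , _) = window-unique , R-wellDefined , ~-isAbelianGroup , R-isPCOGroup
  where
  open CyclicQuotient G u
  open NonNegative 0≤u
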